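{- The formula $\neg\top^*\to(\neg\top^*\,*\,\neg\top^*)$ is provable in $LS_{BBI}+\{S,\neq L,EM\}$, i.e. $\emptyset;\emptyset\vdash w:\neg\top^*\to(\neg\top^*\,*\,\neg\top^*)$ is derivable in that calculus for a label variable $w$.
   Context: Formulae: $A ::= p \mid \top\mid\bot\mid\neg A\mid A\vee A\mid A\wedge A\mid A\to A\mid \top^*\mid A*A\mid A\mathrel{ -\!\!*}A$. Labels: $LVar\cup\{\epsilon\}$ ($LVar$ infinite set of label variables, $\epsilon$ a constant). Labelled formula $a:A$; relational atom $(a,b\triangleright c)$; inequality $(a\neq b)$ for labels $a,b$. Sequent $\mathcal{G};\Gamma\vdash\Delta$: $\mathcal{G}$ a set of relational atoms and inequalities, $\Gamma,\Delta$ multisets of labelled formulae; commas denote union. $[y/x]$ ($x$ a label variable) is uniform replacement. $\neg A$ abbreviates $A\to\bot$, $A\vee B$ abbreviates $\neg A\to B$. Rules of $LS_{BBI}$ (premises $\Rightarrow$ conclusion; fresh = label variable not in conclusion): $id$: axiom $\mathcal{G};\Gamma,w:p\vdash w:p,\Delta$ ($p$ a propositional variable); $cut$: $\mathcal{G};\Gamma\vdash x:A,\Delta$ and $\mathcal{G}';\Gamma',x:A\vdash\Delta'\Rightarrow\mathcal{G},\mathcal{G}';\Gamma,\Gamma'\vdash\Delta,\Delta'$; $\bot L$: axiom $\mathcal{G};\Gamma,w:\bot\vdash\Delta$; $\top R$: axiom $\mathcal{G};\Gamma\vdash w:\top,\Delta$; $\top^*R$: axiom $\mathcal{G};\Gamma\vdash\epsilon:\top^*,\Delta$;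 $\top^*L$: $(\epsilon,w\triangleright\epsilon),\mathcal{G};\Gamma\vdash\Delta\Rightarrow\mathcal{G};\Gamma,w:\top^*\vdash\Delta$; $\wedge L$: $\mathcal{G};\Gamma,w:A,w:B\vdash\Delta\Rightarrow\mathcal{G};\Gamma,w:A\wedge B\vdash\Delta$; $\wedge R$: $\mathcal{G};\Gamma\vdash w:A,\Delta$ and $\mathcal{G};\Gamma\vdash w:B,\Delta\Rightarrow\mathcal{G};\Gamma\vdash w:A\wedge B,\Delta$; $\to L$: $\mathcal{G};\Gamma\vdash w:A,\Delta$ and $\mathcal{G};\Gamma,w:B\vdash\Delta\Rightarrow\mathcal{G};\Gamma,w:A\to B\vdash\Delta$; $\to R$: $\mathcal{G};\Gamma,w:A\vdash w:B,\Delta\Rightarrow\mathcal{G};\Gamma\vdash w:A\to B,\Delta$; $*L$: $(x,y\triangleright z),\mathcal{G};\Gamma,x:A,y:B\vdash\Delta\Rightarrow\mathcal{G};\Gamma,z:A*B\vdash\Delta$ ($x,y$ fresh); $\mathrel{ -\!\!*}R$: $(x,z\triangleright y),\mathcal{G};\Gamma,x:A\vdash y:B,\Delta\Rightarrow\mathcal{G};\Gamma\vdash z:A\mathrel{ -\!\!*}B,\Delta$ ($x,y$ fresh); $*R$: $(x,y\triangleright z),\mathcal{G};\Gamma\vdash x:A,z:A*B,\Delta$ and $(x,y\triangleright z),\mathcal{G};\Gamma\vdash y:B,z:A*B,\Delta\Rightarrow(x,y\triangleright z),\mathcal{G};\Gamma\vdash z:A*B,\Delta$; $\mathrel{ -\!\!*}L$: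 $(x,y\triangleright z),\mathcal{G};\Gamma,y:A\mathrel{ -\!\!*}B\vdash x:A,\Delta$ and $(x,y\triangleright z),\mathcal{G};\Gamma,y:A\mathrel{ -\!\!*}B,z:B\vdash\Delta\Rightarrow(x,y\triangleright z),\mathcal{G};\Gamma,y:A\mathrel{ -\!\!*}B\vdash\Delta$; $E$: $(y,x\triangleright z),(x,y\triangleright z),\mathcal{G};\Gamma\vdash\Delta\Rightarrow(x,y\triangleright z),\mathcal{G};\Gamma\vdash\Delta$; $A$: $(u,w\triangleright z),(y,v\triangleright w),(x,y\triangleright z),(u,v\triangleright x),\mathcal{G};\Gamma\vdash\Delta\Rightarrow(x,y\triangleright z),(u,v\triangleright x),\mathcal{G};\Gamma\vdash\Delta$ ($w$ fresh); $U$: $(x,\epsilon\triangleright x),\mathcal{G};\Gamma\vdash\Delta\Rightarrow\mathcal{G};\Gamma\vdash\Delta$; $A_C$: $(x,w\triangleright x),(y,y\triangleright w),(x,y\triangleright x),\mathcal{G};\Gamma\vdash\Delta\Rightarrow(x,y\triangleright x),\mathcal{G};\Gamma\vdash\Delta$ ($w$ fresh); $Eq_1$: $(\epsilon,w'\triangleright w'),\mathcal{G}[w'/w];\Gamma[w'/w]\vdash\Delta[w'/w]\Rightarrow(\epsilon,w\triangleright w'),\mathcal{G};\Gamma\vdash\Delta$; $Eq_2$: same premise $\Rightarrow(\epsilon,w'\triangleright w),\mathcal{G};\Gamma\vdash\Delta$ (in $Eq_1,Eq_2$, $w$ a label variable). Additional rules: $S$: $(x,y\triangleright z),(x\neq\epsilon),(y\neq\epsilon),(z\neq\epsilon),\mathcal{G};\Gamma\vdash\Delta\Rightarrow(z\neq\epsilon),\mathcal{G};\Gamma\vdash\Delta$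 ($x,y$ fresh); $\neq L$: axiom $(w\neq w),\mathcal{G};\Gamma\vdash\Delta$; $EM$: $(w\neq\epsilon),\mathcal{G};\Gamma\vdash\Delta$ and $(\epsilon,w\triangleright\epsilon),\mathcal{G};\Gamma\vdash\Delta\Rightarrow\mathcal{G};\Gamma\vdash\Delta$. -}

module Defs where

open import Data.Nat using (ℕ)
open import Data.List using (List; []; _∷_; _++_; map)
open import Data.List.Membership.Propositional using (_∈_; _∉_)
open import Data.List.Relation.Binary.Permutation.Propositional using (_↭_)
open import Data.Product using (_×_; _,_)
open import Relation.Binary.PropositionalEquality using (_≡_; _≢_)
open import Relation.Nullary using (¬_)
open import Data.Bool using (if_then_else_)
open import Data.Nat using (_≡ᵇ_)

data Formula : Set where
  var   : ℕ → Formula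
  ⊤′ ⊥′ : Formula
  _∧′_ _→′_ : Formula → Formula → Formula
  ⊤*    : Formula
  _*′_ _-*_ : Formula → Formula → Formula

¬′_ : Formula → Formula
¬′ A = A →′ ⊥′

_∨′_ : Formula → Formula → Formula
A ∨′ B = (¬′ A) →′ B

data Label : Set where
  lv : ℕ → Label
  ε  : Label

record LFormula : Set where
  constructor _∶_
  field
    lab : Label
    fml : Formula

data RAtom : Set where
  ⟨_,_▷_⟩ : Label → Label → Label → RAtom
  _≠_     : Label → Label → RAtom

-- Sequents  G ; Γ ⊢ Δ  with G a set (list up to same elements),
-- Γ, Δ multisets (lists up to permutation); commas = concatenation.
Rel = List RAtom
Ctx = List LFormula

OccL : ℕ → Label → Set
OccL x l = l ≡ lv x

data OccR (x : ℕ) : RAtom → Set where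
  o₁ : ∀ {a b c} → OccL x a → OccR x ⟨ a , b ▷ c ⟩
  o₂ : ∀ {a b c} → OccL x b → OccR x ⟨ a , b ▷ c ⟩
  o₃ : ∀ {a b c} → OccL x c → OccR x ⟨ a , b ▷ c ⟩
  o₄ : ∀ {a b} → OccL x a → OccR x (a ≠ b)
  o₅ : ∀ {a b} → OccL x b → OccR x (a ≠ b)

data OccRs (x : ℕ) : Rel → Set where
  here  : ∀ {r G} → OccR x r → OccRs x (r ∷ G)
  there : ∀ {r G} → OccRs x G → OccRs x (r ∷ G)

data OccC (x : ℕ) : Ctx → Set where
  here  : ∀ {A Γ} → OccL x (LFormula.lab A) → OccC x (A ∷ Γ)
  there : ∀ {A Γ} → OccC x Γ → OccC x (A ∷ Γ)

Fresh : ℕ → Rel → Ctx → Ctx → Set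
Fresh x G Γ Δ = ¬ OccRs x G × ¬ OccC x Γ × ¬ OccC x Δ

substL : Label → ℕ → Label → Label
substL y x (lv z) = if z ≡ᵇ x then y else lv z
substL y x ε      = ε

substR : Label → ℕ → RAtom → RAtom
substR y x ⟨ a , b ▷ c ⟩ = ⟨ substL y x a , substL y x b ▷ substL y x c ⟩
substR y x (a ≠ b)       = substL y x a ≠ substL y x b

substRs : Label → ℕ → Rel → Rel
substRs y x = map (substR y x)

substC : Label → ℕ → Ctx → Ctx
substC y x = map (λ { (l ∶ A) → substL y x l ∶ A })

_≈ₛ_ : Rel → Rel → Set
G ≈ₛ G' = (∀ {r} → r ∈ G → r ∈ G') × (∀ {r} → r ∈ G' → r ∈ G)

infix 3 _⨾_⊢_
data _⨾_⊢_ : Rel → Ctx → Ctx → Set where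
  struct : ∀ {G G' Γ Γ' Δ Δ'} → G ≈ₛ G' → Γ ↭ Γ' → Δ ↭ Δ' →
           G ⨾ Γ ⊢ Δ → G' ⨾ Γ' ⊢ Δ'
  id   : ∀ {G Γ Δ w p} → G ⨾ (w ∶ var p) ∷ Γ ⊢ (w ∶ var p) ∷ Δ
  cut  : ∀ {G G' Γ Γ' Δ Δ' x A} →
         G ⨾ Γ ⊢ (x ∶ A) ∷ Δ → G' ⨾ (x ∶ A) ∷ Γ' ⊢ Δ' →
         G ++ G' ⨾ Γ ++ Γ' ⊢ Δ ++ Δ'
  ⊥L   : ∀ {G Γ Δ w} → G ⨾ (w ∶ ⊥′) ∷ Γ ⊢ Δ
  ⊤R   : ∀ {G Γ Δ w} → G ⨾ Γ ⊢ (w ∶ ⊤′) ∷ Δ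
  ⊤*R  : ∀ {G Γ Δ} → G ⨾ Γ ⊢ (ε ∶ ⊤*) ∷ Δ
  ⊤*L  : ∀ {G Γ Δ w} → ⟨ ε , w ▷ ε ⟩ ∷ G ⨾ Γ ⊢ Δ → G ⨾ (w ∶ ⊤*) ∷ Γ ⊢ Δ
  ∧L   : ∀ {G Γ Δ w A B} → G ⨾ (w ∶ A) ∷ (w ∶ B) ∷ Γ ⊢ Δ →
         G ⨾ (w ∶ (A ∧′ B)) ∷ Γ ⊢ Δ
  ∧R   : ∀ {G Γ Δ w A B} → G ⨾ Γ ⊢ (w ∶ A) ∷ Δ → G ⨾ Γ ⊢ (w ∶ B) ∷ Δ →
         G ⨾ Γ ⊢ (w ∶ (A ∧′ B)) ∷ Δ
  →L   : ∀ {G Γ Δ w A B} → G ⨾ Γ ⊢ (w ∶ A) ∷ Δ → G ⨾ (w ∶ B) ∷ Γ ⊢ Δ →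
         G ⨾ (w ∶ (A →′ B)) ∷ Γ ⊢ Δ
  →R   : ∀ {G Γ Δ w A B} → G ⨾ (w ∶ A) ∷ Γ ⊢ (w ∶ B) ∷ Δ →
         G ⨾ Γ ⊢ (w ∶ (A →′ B)) ∷ Δ
  *L   : ∀ {G Γ Δ x y z A B} →
         Fresh x G ((z ∶ (A *′ B)) ∷ Γ) Δ → Fresh y G ((z ∶ (A *′ B)) ∷ Γ) Δ →
         x ≢ y →
         ⟨ lv x , lv y ▷ z ⟩ ∷ G ⨾ (lv x ∶ A) ∷ (lv y ∶ B) ∷ Γ ⊢ Δ →
         G ⨾ (z ∶ (A *′ B)) ∷ Γ ⊢ Δ
  -*R  : ∀ {G Γ Δ x y z A B} →
         Fresh x G Γ ((z ∶ (A -* B)) ∷ Δ) → Fresh y G Γ ((z ∶ (A -* B)) ∷ Δ) →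
         x ≢ y →
         ⟨ lv x , z ▷ lv y ⟩ ∷ G ⨾ (lv x ∶ A) ∷ Γ ⊢ (lv y ∶ B) ∷ Δ →
         G ⨾ Γ ⊢ (z ∶ (A -* B)) ∷ Δ
  *R   : ∀ {G Γ Δ x y z A B} →
         ⟨ x , y ▷ z ⟩ ∷ G ⨾ Γ ⊢ (x ∶ A) ∷ (z ∶ (A *′ B)) ∷ Δ →
         ⟨ x , y ▷ z ⟩ ∷ G ⨾ Γ ⊢ (y ∶ B) ∷ (z ∶ (A *′ B)) ∷ Δ →
         ⟨ x , y ▷ z ⟩ ∷ G ⨾ Γ ⊢ (z ∶ (A *′ B)) ∷ Δ
  -*L  : ∀ {G Γ Δ x y z A B} →
         ⟨ x , y ▷ z ⟩ ∷ G ⨾ (y ∶ (A -* B)) ∷ Γ ⊢ (x ∶ A) ∷ Δ →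
         ⟨ x , y ▷ z ⟩ ∷ G ⨾ (y ∶ (A -* B)) ∷ (z ∶ B) ∷ Γ ⊢ Δ →
         ⟨ x , y ▷ z ⟩ ∷ G ⨾ (y ∶ (A -* B)) ∷ Γ ⊢ Δ
  E    : ∀ {G Γ Δ x y z} →
         ⟨ y , x ▷ z ⟩ ∷ ⟨ x , y ▷ z ⟩ ∷ G ⨾ Γ ⊢ Δ →
         ⟨ x , y ▷ z ⟩ ∷ G ⨾ Γ ⊢ Δ
  A    : ∀ {G Γ Δ x y z u v w} →
         Fresh w (⟨ x , y ▷ z ⟩ ∷ ⟨ u , v ▷ x ⟩ ∷ G) Γ Δ →
         ⟨ u , lv w ▷ z ⟩ ∷ ⟨ y , v ▷ lv w ⟩ ∷ ⟨ x , y ▷ z ⟩ ∷ ⟨ u , v ▷ x ⟩ ∷ G ⨾ Γ ⊢ Δ →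
         ⟨ x , y ▷ z ⟩ ∷ ⟨ u , v ▷ x ⟩ ∷ G ⨾ Γ ⊢ Δ
  U    : ∀ {G Γ Δ x} → ⟨ x , ε ▷ x ⟩ ∷ G ⨾ Γ ⊢ Δ → G ⨾ Γ ⊢ Δ
  AC   : ∀ {G Γ Δ x y w} →
         Fresh w (⟨ x , y ▷ x ⟩ ∷ G) Γ Δ →
         ⟨ x , lv w ▷ x ⟩ ∷ ⟨ y , y ▷ lv w ⟩ ∷ ⟨ x , y ▷ x ⟩ ∷ G ⨾ Γ ⊢ Δ →
         ⟨ x , y ▷ x ⟩ ∷ G ⨾ Γ ⊢ Δ
  Eq₁  : ∀ {G Γ Δ w w'} →
         ⟨ ε , w' ▷ w' ⟩ ∷ substRs w' w G ⨾ substC w' w Γ ⊢ substC w' w Δ →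
         ⟨ ε , lv w ▷ w' ⟩ ∷ G ⨾ Γ ⊢ Δ
  Eq₂  : ∀ {G Γ Δ w w'} →
         ⟨ ε , w' ▷ w' ⟩ ∷ substRs w' w G ⨾ substC w' w Γ ⊢ substC w' w Δ →
         ⟨ ε , w' ▷ lv w ⟩ ∷ G ⨾ Γ ⊢ Δ
  S    : ∀ {G Γ Δ x y z} →
         Fresh x ((z ≠ ε) ∷ G) Γ Δ → Fresh y ((z ≠ ε) ∷ G) Γ Δ → x ≢ y →
         ⟨ lv x , lv y ▷ z ⟩ ∷ (lv x ≠ ε) ∷ (lv y ≠ ε) ∷ (z ≠ ε) ∷ G ⨾ Γ ⊢ Δ →
         (z ≠ ε) ∷ G ⨾ Γ ⊢ Δ
  ≠L   : ∀ {G Γ Δ w} → (w ≠ w) ∷ G ⨾ Γ ⊢ Δ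
  EM   : ∀ {G Γ Δ w} →
         (w ≠ ε) ∷ G ⨾ Γ ⊢ Δ → ⟨ ε , w ▷ ε ⟩ ∷ G ⨾ Γ ⊢ Δ → G ⨾ Γ ⊢ Δ

-- Excluded middle on w: if w is the unit, Eq₁ turns the hypothesis w : ¬⊤* into
-- ε : ¬⊤*, refuted by ⊤*R.  Otherwise S splits w into two non-unit worlds x, y,
-- and each of x : ¬⊤*, y : ¬⊤* holds, since assuming ⊤* at a non-unit world and
-- collapsing it to ε with Eq₁ produces the contradictory atom (ε ≠ ε).
module Submission where

open import Defs
open import Data.Bool.Properties using (T-≡)
open import Data.List using ([]; _∷_)
open import Data.List.Membership.Propositional using (_∈_)
open import Data.List.Membership.Propositional.Properties using (∈-map⁺)
open import Data.List.Relation.Binary.Permutation.Propositional using (↭-refl)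
open import Data.List.Relation.Unary.Any using (here; there)
open import Data.Nat using (ℕ; suc)
open import Data.Nat.Properties using (≡⇒≡ᵇ)
open import Data.Product using (_,_)
open import Function.Bundles using (Equivalence)
open import Relation.Binary.PropositionalEquality using (_≡_; _≢_; refl; sym; subst)

substL-self : ∀ y x → substL y x (lv x) ≡ y
substL-self y x rewrite Equivalence.to T-≡ (≡⇒≡ᵇ x x refl) = refl

≠L-∈ : ∀ {G Γ Δ w} → (w ≠ w) ∈ G → G ⨾ Γ ⊢ Δ
≠L-∈ w≠w∈G = struct (weaken , there) ↭-refl ↭-refl ≠L
  where
  weaken : ∀ {r} → r ∈ _ → r ∈ _
  weaken (here refl) = w≠w∈G
  weaken (there r∈G) = r∈G

unit-refutes-¬⊤* : ∀ {G Γ Δ x} → ⟨ ε , lv x ▷ ε ⟩ ∷ G ⨾ (lv x ∶ (¬′ ⊤*)) ∷ Γ ⊢ Δ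
unit-refutes-¬⊤* {G} {Γ} {Δ} {x} = Eq₁ (subst refutes (sym (substL-self ε x)) (→L ⊤*R ⊥L))
  where
  refutes : Label → Set
  refutes l = ⟨ ε , ε ▷ ε ⟩ ∷ substRs ε x G ⨾ (l ∶ (¬′ ⊤*)) ∷ substC ε x Γ ⊢ substC ε x Δ

nonunit-¬⊤* : ∀ {G Γ Δ x} → (lv x ≠ ε) ∈ G → G ⨾ Γ ⊢ (lv x ∶ (¬′ ⊤*)) ∷ Δ
nonunit-¬⊤* {G} {x = x} x≠ε∈G = →R (⊤*L (Eq₁ (≠L-∈ (there ε≠ε∈G))))
  where
  ε≠ε∈G : (ε ≠ ε) ∈ substRs ε x G
  ε≠ε∈G = subst (λ l → (l ≠ ε) ∈ substRs ε x G) (substL-self ε x)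
                (∈-map⁺ (substR ε x) x≠ε∈G)

nonunit-¬⊤*-*-¬⊤* : ∀ {G Γ Δ x y z} →
  let Δ′ = (z ∶ ((¬′ ⊤*) *′ (¬′ ⊤*))) ∷ Δ in
  Fresh x ((z ≠ ε) ∷ G) Γ Δ′ → Fresh y ((z ≠ ε) ∷ G) Γ Δ′ → x ≢ y →
  (z ≠ ε) ∷ G ⨾ Γ ⊢ Δ′
nonunit-¬⊤*-*-¬⊤* x-fresh y-fresh x≢y =
  S x-fresh y-fresh x≢y
    (*R (nonunit-¬⊤* (there (here refl))) (nonunit-¬⊤* (there (there (here refl)))))

fresh-for-single-world : ∀ {x w A B} → x ≢ w →
  Fresh x ((lv w ≠ ε) ∷ []) ((lv w ∶ A) ∷ []) ((lv w ∶ B) ∷ [])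
fresh-for-single-world x≢w =
  (λ { (here (o₄ refl)) → x≢w refl ; (here (o₅ ())) ; (there ()) }) ,
  (λ { (here refl) → x≢w refl ; (there ()) }) ,
  (λ { (here refl) → x≢w refl ; (there ()) })

mainTheorem11 : (w : ℕ) →
    [] ⨾ [] ⊢ (lv w ∶ ((¬′ ⊤*) →′ ((¬′ ⊤*) *′ (¬′ ⊤*)))) ∷ []
mainTheorem11 w = →R (EM {w = lv w} w-nonunit unit-refutes-¬⊤*)
  where
  w-nonunit : (lv w ≠ ε) ∷ [] ⨾ (lv w ∶ (¬′ ⊤*)) ∷ [] ⊢ (lv w ∶ ((¬′ ⊤*) *′ (¬′ ⊤*))) ∷ []
  w-nonunit = nonunit-¬⊤*-*-¬⊤* {x = suc w} {y = suc (suc w)}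
    (fresh-for-single-world λ ()) (fresh-for-single-world λ ()) λ ()
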